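{- For every integer $n \ge 0$, $H_{01}(n) = 2\,H_{1}(n)$, where $H_{1}(n)$ and $H_{01}(n)$ are defined as follows for a set $V$ of $n$ propositional variables: $H_{1}(n)$ is the number of distinct subsets of $\{0,1\}^n$ that arise as the set of Boolean solutions of some set of binomial equations $m_1 = m_2$ in which each $m_i$ is a (possibly empty) product of variables of $V$ (the empty product being the constant $1$; the constant $0$ is not allowed); and $H_{01}(n)$ is the number of distinct subsets of $\{0,1\}^n$ that arise as the set of Boolean solutions of some set of binomial equations $m_1 = m_2$ in which each $m_i$ is either a (possibly empty) product of variables of $V$ or the constant $0$.
   Context: Variables range over $\{0,1\}$, products are logical conjunctions, the empty product is $1$, and a vector in $\{0,1\}^n$ is a solution of a set of equations if it satisfies every equation in the set. Two sets of equations are counted as the same if they have the same solution set. (Equivalently, $H_1(n)$ counts canonical systems of such binomial equations without the constant $0$, and $H_{01}(n)$ counts those where both constants $0$ and $1$ may occur.) -}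

module Defs where

open import Data.Nat using (ℕ; zero; suc)
open import Data.Bool using (Bool; true; false; not; _∧_; _xor_)
open import Data.Fin using (Fin)
open import Data.Vec using (Vec; []; _∷_; lookup)
open import Data.List using (List; []; _∷_; map; _++_; length)
open import Data.Maybe using (Maybe; just; nothing)
open import Data.Product using (_×_; _,_; Σ; ∃)
open import Data.List.Membership.Propositional using (_∈_)
open import Data.List.Relation.Unary.Unique.Propositional using (Unique)
open import Relation.Binary.PropositionalEquality using (_≡_)
open import Function.Bundles using (_⇔_)

Point : ℕ → Set
Point n = Vec Bool n

allB : {A : Set} → (A → Bool) → List A → Bool
allB p []       = true
allB p (a ∷ as) = p a ∧ allB p as

cube : (n : ℕ) → List (Point n)
cube zero    = [] ∷ []
cube (suc n) = map (false ∷_) (cube n) ++ map (true ∷_) (cube n)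

-- A subset of {0,1}^n is represented by its characteristic table along
-- the enumeration 'cube n'; equal tables ⇔ equal subsets.
CubeSubset : Set
CubeSubset = List Bool

table : (n : ℕ) → (Point n → Bool) → CubeSubset
table n S = map S (cube n)

-- A monomial: a (possibly empty) product of variables; [] is the constant 1.
Monomial : ℕ → Set
Monomial n = List (Fin n)

evalMon : {n : ℕ} → Monomial n → Point n → Bool
evalMon m x = allB (λ i → lookup x i) m

-- A term for H_{01}: either a monomial (just m) or the constant 0 (nothing).
Term01 : ℕ → Set
Term01 n = Maybe (Monomial n)

evalTerm01 : {n : ℕ} → Term01 n → Point n → Bool
evalTerm01 (just m) x = evalMon m x
evalTerm01 nothing  x = false

_==b_ : Bool → Bool → Bool
a ==b b = not (a xor b)

sols1 : {n : ℕ} → List (Monomial n × Monomial n) → Point n → Bool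
sols1 eqs x = allB (λ { (m₁ , m₂) → evalMon m₁ x ==b evalMon m₂ x }) eqs

sols01 : {n : ℕ} → List (Term01 n × Term01 n) → Point n → Bool
sols01 eqs x = allB (λ { (t₁ , t₂) → evalTerm01 t₁ x ==b evalTerm01 t₂ x }) eqs

Realizable1 : (n : ℕ) → CubeSubset → Set
Realizable1 n S = ∃ λ (eqs : List (Monomial n × Monomial n)) → S ≡ table n (sols1 eqs)

Realizable01 : (n : ℕ) → CubeSubset → Set
Realizable01 n S = ∃ λ (eqs : List (Term01 n × Term01 n)) → S ≡ table n (sols01 eqs)

HasCount : (CubeSubset → Set) → ℕ → Set
HasCount P k = Σ (List CubeSubset) λ L →
  length L ≡ k × Unique L × (∀ S → (S ∈ L) ⇔ P S)

H1is : ℕ → ℕ → Set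
H1is n k = HasCount (Realizable1 n) k

H01is : ℕ → ℕ → Set
H01is n k = HasCount (Realizable01 n) k

-- Every H₁-set contains the all-ones point 𝟏, where every monomial evaluates to 1. In a
-- system that uses the constant 0, replace 0 by the product of all variables: this changes
-- nothing away from 𝟏, so the solution set is an H₁-set S or S ∖ {𝟏}, according as 𝟏 is a
-- solution; conversely S ∖ {𝟏} is cut out by adding the equation "product of all
-- variables = 0". As S ↦ S ∖ {𝟏} is injective on H₁-sets and its image misses them, there
-- are twice as many H₀₁-sets as H₁-sets. There are finitely many H₁-sets because, once each
-- monomial is normalised to a sublist of the variable list, a system depends only on the
-- set of its equations, which is a sublist of a fixed finite list.
module Submission where

open import Defs
open import Data.Nat using (ℕ; suc; _*_; _+_)
open import Data.Nat.Properties using (+-identityʳ)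
open import Data.Bool using (Bool; true; false; not; _∧_)
open import Data.Bool.Properties using (∧-identityʳ; ∧-zeroʳ) renaming (_≟_ to _≟ᵇ_)
open import Data.Fin using (Fin) renaming (_≟_ to _≟ᶠ_)
open import Data.Vec using ([]; _∷_; lookup; replicate; tabulate)
open import Data.Vec.Properties using (lookup-replicate; tabulate∘lookup; tabulate-cong)
open import Data.List using (List; []; _∷_; map; _++_; length; filter; zipWith; allFin;
  cartesianProduct; deduplicate)
open import Data.List.Properties using (map-cong; length-++; length-map)
import Data.List.Properties as List
open import Data.List.Membership.Propositional using (_∈_)
open import Data.List.Membership.Propositional.Properties using (∈-map⁺; ∈-map⁻; ∈-++⁺ˡ;
  ∈-++⁺ʳ; ∈-++⁻; ∈-filter⁺; ∈-filter⁻; ∈-allFin; ∈-cartesianProduct⁺; ∈-deduplicate⁺;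
  ∈-deduplicate⁻)
import Data.List.Membership.DecPropositional
open import Data.List.Relation.Unary.Any using (here; there)
open import Data.List.Relation.Unary.All as All using (All; []; _∷_)
open import Data.List.Relation.Unary.All.Properties as All using ()
open import Data.List.Relation.Unary.Unique.Propositional using (Unique; []; _∷_)
open import Data.List.Relation.Unary.Unique.Propositional.Properties using (++⁺)
open import Data.List.Relation.Unary.Unique.DecPropositional.Properties using (deduplicate-!)
open import Data.List.Relation.Binary.Subset.Propositional using (_⊆_)
open import Data.Maybe using (just; nothing)
open import Data.Product using (Σ; _×_; _,_; proj₁; proj₂; ∃)
import Data.Product as Product
import Data.Product.Properties as Product
open import Data.Sum using (_⊎_; inj₁; inj₂)
open import Function using (_∘_)
open import Function.Bundles using (_⇔_; mk⇔; Equivalence)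
open import Function.Properties.Equivalence using () renaming (sym to ⇔-sym)
open import Relation.Binary.PropositionalEquality
open import Relation.Binary.Definitions using (DecidableEquality)
open import Relation.Nullary using (¬_; does)
open import Relation.Unary using (Decidable)

private
  variable
    A B : Set
    n k : ℕ

≡-from-≡true : {b c : Bool} → (b ≡ true → c ≡ true) → (c ≡ true → b ≡ true) → b ≡ c
≡-from-≡true {true}  {true}  _ _ = refl
≡-from-≡true {true}  {false} f _ = sym (f refl)
≡-from-≡true {false} {true}  _ g = g refl
≡-from-≡true {false} {false} _ _ = refl

module _ (p : A → Bool) where

  allB⁻ : {xs : List A} → allB p xs ≡ true → {a : A} → a ∈ xs → p a ≡ true
  allB⁻ {x ∷ _} h (here refl) with p x
  ... | true = refl
  allB⁻ {x ∷ _} h (there a∈xs) with p x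
  ... | true = allB⁻ h a∈xs

  allB⁺ : {xs : List A} → ({a : A} → a ∈ xs → p a ≡ true) → allB p xs ≡ true
  allB⁺ {[]}     _ = refl
  allB⁺ {x ∷ xs} h rewrite h (here refl) = allB⁺ (h ∘ there)

  allB-antimono : {xs ys : List A} → xs ⊆ ys → allB p ys ≡ true → allB p xs ≡ true
  allB-antimono xs⊆ys h = allB⁺ (allB⁻ h ∘ xs⊆ys)

  allB-cong-⊆⊇ : {xs ys : List A} → xs ⊆ ys → ys ⊆ xs → allB p xs ≡ allB p ys
  allB-cong-⊆⊇ xs⊆ys ys⊆xs = ≡-from-≡true (allB-antimono ys⊆xs) (allB-antimono xs⊆ys)

  allB-++ : (xs ys : List A) → allB p (xs ++ ys) ≡ allB p xs ∧ allB p ys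
  allB-++ []       ys = refl
  allB-++ (x ∷ xs) ys rewrite allB-++ xs ys with p x
  ... | true  = refl
  ... | false = refl

allB-map-≗ : {p : B → Bool} {q : A → Bool} (f : A → B) → (∀ a → p (f a) ≡ q a) →
             (xs : List A) → allB p (map f xs) ≡ allB q xs
allB-map-≗ f pf≗q []       = refl
allB-map-≗ f pf≗q (x ∷ xs) = cong₂ _∧_ (pf≗q x) (allB-map-≗ f pf≗q xs)

map-≡⇒≗-on : {f g : A → B} {xs : List A} → map f xs ≡ map g xs → {x : A} → x ∈ xs → f x ≡ g x
map-≡⇒≗-on {xs = _ ∷ _} eq (here refl)  = proj₁ (List.∷-injective eq)
map-≡⇒≗-on {xs = _ ∷ _} eq (there x∈xs) = map-≡⇒≗-on (proj₂ (List.∷-injective eq)) x∈xs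

zipWith-map-self : (f : B → A → B) (g : A → B) (xs : List A) →
                   zipWith f (map g xs) xs ≡ map (λ x → f (g x) x) xs
zipWith-map-self f g []       = refl
zipWith-map-self f g (x ∷ xs) = cong (_ ∷_) (zipWith-map-self f g xs)

sublists : List A → List (List A)
sublists []       = [] ∷ []
sublists (x ∷ xs) = sublists xs ++ map (x ∷_) (sublists xs)

filter∈sublists : {P : A → Set} (P? : Decidable P) (xs : List A) → filter P? xs ∈ sublists xs
filter∈sublists P? []       = here refl
filter∈sublists P? (x ∷ xs) with does (P? x)
... | false = ∈-++⁺ˡ (filter∈sublists P? xs)
... | true  = ∈-++⁺ʳ (sublists xs) (∈-map⁺ (x ∷_) (filter∈sublists P? xs))

Unique-map⁺-on : {P : A → Set} {f : A → B} →
                 (∀ {x y} → P x → P y → f x ≡ f y → x ≡ y) →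
                 {xs : List A} → All P xs → Unique xs → Unique (map f xs)
Unique-map⁺-on inj []         []              = []
Unique-map⁺-on inj (px ∷ pxs) (x∉xs ∷ xs!) =
  All.map⁺ (All.map (λ (py , x≢y) → x≢y ∘ inj px py) (All.zip (pxs , x∉xs)))
  ∷ Unique-map⁺-on inj pxs xs!

HasCount-⇔ : {P Q : CubeSubset → Set} → HasCount P k → (∀ S → P S ⇔ Q S) → HasCount Q k
HasCount-⇔ (L , len , L! , L⇔P) P⇔Q =
  L , len , L! , λ S → mk⇔ (to (P⇔Q S) ∘ to (L⇔P S)) (from (L⇔P S) ∘ from (P⇔Q S))
  where open Equivalence

HasCount-enumeration : {P : CubeSubset → Set} (xs : List CubeSubset) → (∀ S → S ∈ xs ⇔ P S) →
                       HasCount P (length (deduplicate (List.≡-dec _≟ᵇ_) xs))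
HasCount-enumeration xs xs⇔P =
  deduplicate _≟ₜ_ xs , refl , deduplicate-! _≟ₜ_ xs ,
  λ S → mk⇔ (to (xs⇔P S) ∘ ∈-deduplicate⁻ _≟ₜ_ xs) (∈-deduplicate⁺ _≟ₜ_ ∘ from (xs⇔P S))
  where
  open Equivalence
  _≟ₜ_ : DecidableEquality CubeSubset
  _≟ₜ_ = List.≡-dec _≟ᵇ_

HasCount-⊎-image : {P : CubeSubset → Set} (f : CubeSubset → CubeSubset) → HasCount P k →
                   (∀ {S T} → P S → P T → f S ≡ f T → S ≡ T) →
                   (∀ {S T} → P S → P T → S ≢ f T) →
                   HasCount (λ S → P S ⊎ ∃ λ T → P T × S ≡ f T) (2 * k)
HasCount-⊎-image {P = P} f (L , refl , L! , L⇔P) inj disj =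
  L ++ map f L , length-doubles , ++⁺ L! (Unique-map⁺-on inj all-P L!) disjoint ,
  λ S → mk⇔ ∈⇒ (⇒∈ S)
  where
  open Equivalence using (to; from)
  all-P : All P L
  all-P = All.tabulate (λ {S} → to (L⇔P S))

  length-doubles : length (L ++ map f L) ≡ 2 * length L
  length-doubles = trans (length-++ L)
    (cong (length L +_) (trans (length-map f L) (sym (+-identityʳ _))))

  disjoint : ∀ {S} → ¬ (S ∈ L × S ∈ map f L)
  disjoint (S∈L , S∈fL) with ∈-map⁻ f S∈fL
  ... | T , T∈L , S≡fT = disj (to (L⇔P _) S∈L) (to (L⇔P T) T∈L) S≡fT

  ∈⇒ : ∀ {S} → S ∈ L ++ map f L → P S ⊎ ∃ λ T → P T × S ≡ f T
  ∈⇒ {S} S∈ with ∈-++⁻ L S∈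
  ... | inj₁ S∈L  = inj₁ (to (L⇔P S) S∈L)
  ... | inj₂ S∈fL = let T , T∈L , S≡fT = ∈-map⁻ f S∈fL in
                    inj₂ (T , to (L⇔P T) T∈L , S≡fT)

  ⇒∈ : ∀ S → P S ⊎ ∃ (λ T → P T × S ≡ f T) → S ∈ L ++ map f L
  ⇒∈ S (inj₁ PS)              = ∈-++⁺ˡ (from (L⇔P S) PS)
  ⇒∈ S (inj₂ (T , PT , refl)) = ∈-++⁺ʳ L (∈-map⁺ f (from (L⇔P T) PT))

∈-cube : (x : Point n) → x ∈ cube n
∈-cube []                 = here refl
∈-cube {suc n} (false ∷ x) = ∈-++⁺ˡ (∈-map⁺ (false ∷_) (∈-cube x))
∈-cube {suc n} (true ∷ x)  = ∈-++⁺ʳ (map (false ∷_) (cube n)) (∈-map⁺ (true ∷_) (∈-cube x))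

table-injective : {S S′ : Point n → Bool} → table n S ≡ table n S′ → S ≗ S′
table-injective eq x = map-≡⇒≗-on eq (∈-cube x)

table-cong : {S S′ : Point n → Bool} → S ≗ S′ → table n S ≡ table n S′
table-cong S≗S′ = map-cong S≗S′ _

𝟏 : Point n
𝟏 {n} = replicate n true

is𝟏 : Point n → Bool
is𝟏 {n} = evalMon (allFin n)

evalMon-𝟏 : (m : Monomial n) → evalMon m 𝟏 ≡ true
evalMon-𝟏 {n} m = allB⁺ (lookup (𝟏 {n})) {m} (λ {i} _ → lookup-replicate i true)

is𝟏⇒≡𝟏 : (x : Point n) → is𝟏 x ≡ true → x ≡ 𝟏
is𝟏⇒≡𝟏 x h = begin
  x                   ≡⟨ tabulate∘lookup x ⟨
  tabulate (lookup x) ≡⟨ tabulate-cong lookup-x≗𝟏 ⟩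
  tabulate (lookup 𝟏) ≡⟨ tabulate∘lookup 𝟏 ⟩
  𝟏                   ∎
  where
  open ≡-Reasoning
  lookup-x≗𝟏 : ∀ i → lookup x i ≡ lookup 𝟏 i
  lookup-x≗𝟏 i = trans (allB⁻ _ h (∈-allFin i)) (sym (lookup-replicate i true))

≗-by-𝟏 : {S S′ : Point n → Bool} → S 𝟏 ≡ S′ 𝟏 →
         (∀ x → is𝟏 x ≡ false → S x ≡ S′ x) → S ≗ S′
≗-by-𝟏 {S = S} {S′} at𝟏 off𝟏 x with is𝟏 x in eq
... | true  = subst (λ y → S y ≡ S′ y) (sym (is𝟏⇒≡𝟏 x eq)) at𝟏
... | false = off𝟏 x eq

Equation : ℕ → Set
Equation n = Monomial n × Monomial n

holds : Equation n → Point n → Bool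
holds (m₁ , m₂) x = evalMon m₁ x ==b evalMon m₂ x

holds01 : Term01 n × Term01 n → Point n → Bool
holds01 (t₁ , t₂) x = evalTerm01 t₁ x ==b evalTerm01 t₂ x

sols1-𝟏 : (eqs : List (Equation n)) → sols1 eqs 𝟏 ≡ true
sols1-𝟏 {n} eqs = allB⁺ (λ e → holds e (𝟏 {n})) {eqs}
  (λ { {m₁ , m₂} _ → cong₂ _==b_ (evalMon-𝟏 m₁) (evalMon-𝟏 m₂) })

∈-monomial? : (m : Monomial n) → Decidable (_∈ m)
∈-monomial? m i = Data.List.Membership.DecPropositional._∈?_ _≟ᶠ_ i m

normalise : Monomial n → Monomial n
normalise {n} m = filter (∈-monomial? m) (allFin n)

evalMon-normalise : (m : Monomial n) → evalMon (normalise m) ≗ evalMon m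
evalMon-normalise {n} m x =
  allB-cong-⊆⊇ (lookup x) (proj₂ ∘ ∈-filter⁻ (∈-monomial? m) {xs = allFin n})
                          (λ {i} → ∈-filter⁺ (∈-monomial? m) (∈-allFin i))

normaliseEq : Equation n → Equation n
normaliseEq = Product.map normalise normalise

holds-normaliseEq : (e : Equation n) → holds (normaliseEq e) ≗ holds e
holds-normaliseEq (m₁ , m₂) x = cong₂ _==b_ (evalMon-normalise m₁ x) (evalMon-normalise m₂ x)

equations : (n : ℕ) → List (Equation n)
equations n = cartesianProduct (sublists (allFin n)) (sublists (allFin n))

normaliseEq∈equations : (e : Equation n) → normaliseEq e ∈ equations n
normaliseEq∈equations {n} (m₁ , m₂) =
  ∈-cartesianProduct⁺ (filter∈sublists (∈-monomial? m₁) (allFin n))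
                      (filter∈sublists (∈-monomial? m₂) (allFin n))

∈-equations? : (eqs : List (Equation n)) → Decidable (_∈ eqs)
∈-equations? eqs e = Data.List.Membership.DecPropositional._∈?_
  (Product.≡-dec (List.≡-dec _≟ᶠ_) (List.≡-dec _≟ᶠ_)) e eqs

canonical : List (Equation n) → List (Equation n)
canonical {n} eqs = filter (∈-equations? (map normaliseEq eqs)) (equations n)

canonical∈sublists : (eqs : List (Equation n)) → canonical eqs ∈ sublists (equations n)
canonical∈sublists {n} eqs = filter∈sublists (∈-equations? (map normaliseEq eqs)) (equations n)

sols1-canonical : (eqs : List (Equation n)) → sols1 eqs ≗ sols1 (canonical eqs)
sols1-canonical eqs x = begin
  sols1 eqs x                                  ≡⟨ allB-map-≗ normaliseEq holds-x eqs ⟨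
  allB (λ e → holds e x) (map normaliseEq eqs) ≡⟨ allB-cong-⊆⊇ _ normalised⊆canonical
                                                    canonical⊆normalised ⟩
  sols1 (canonical eqs) x                      ∎
  where
  open ≡-Reasoning
  ∈-normalised? : Decidable (_∈ map normaliseEq eqs)
  ∈-normalised? = ∈-equations? (map normaliseEq eqs)
  holds-x : ∀ e → holds (normaliseEq e) x ≡ holds e x
  holds-x e = holds-normaliseEq e x
  canonical⊆normalised : canonical eqs ⊆ map normaliseEq eqs
  canonical⊆normalised = proj₂ ∘ ∈-filter⁻ ∈-normalised? {xs = equations _}
  normalised⊆canonical : map normaliseEq eqs ⊆ canonical eqs
  normalised⊆canonical e∈ with ∈-map⁻ normaliseEq e∈
  ... | e , _ , refl = ∈-filter⁺ ∈-normalised? (normaliseEq∈equations e) e∈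

realizations1 : (n : ℕ) → List CubeSubset
realizations1 n = map (table n ∘ sols1) (sublists (equations n))

∈-realizations1⇔Realizable1 : (S : CubeSubset) → S ∈ realizations1 n ⇔ Realizable1 n S
∈-realizations1⇔Realizable1 {n} S = mk⇔ from-enumeration to-enumeration
  where
  from-enumeration : S ∈ realizations1 n → Realizable1 n S
  from-enumeration S∈ with ∈-map⁻ (table n ∘ sols1) S∈
  ... | eqs , _ , S≡ = eqs , S≡
  to-enumeration : Realizable1 n S → S ∈ realizations1 n
  to-enumeration (eqs , refl) =
    subst (_∈ realizations1 n) (sym (table-cong (sols1-canonical eqs)))
          (∈-map⁺ (table n ∘ sols1) (canonical∈sublists eqs))

without𝟏 : (n : ℕ) → CubeSubset → CubeSubset
without𝟏 n t = zipWith (λ b x → b ∧ not (is𝟏 x)) t (cube n)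

without𝟏-table : (S : Point n → Bool) →
                 without𝟏 n (table n S) ≡ table n (λ x → S x ∧ not (is𝟏 x))
without𝟏-table {n} S = zipWith-map-self (λ b x → b ∧ not (is𝟏 x)) S (cube n)

∧-not-cancelʳ : {b b′ c : Bool} → c ≡ false → b ∧ not c ≡ b′ ∧ not c → b ≡ b′
∧-not-cancelʳ {b} {b′} refl eq = trans (sym (∧-identityʳ b)) (trans eq (∧-identityʳ b′))

without𝟏-injective : {S T : CubeSubset} → Realizable1 n S → Realizable1 n T →
                     without𝟏 n S ≡ without𝟏 n T → S ≡ T
without𝟏-injective {n} (eqs , refl) (eqs′ , refl) eq =
  table-cong (≗-by-𝟏 (trans (sols1-𝟏 eqs) (sym (sols1-𝟏 eqs′)))
                     (λ x x≢𝟏 → ∧-not-cancelʳ x≢𝟏 (table-injective masked x)))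
  where
  masked : table n (λ x → sols1 eqs x ∧ not (is𝟏 x)) ≡ table n (λ x → sols1 eqs′ x ∧ not (is𝟏 x))
  masked = trans (sym (without𝟏-table (sols1 eqs))) (trans eq (without𝟏-table (sols1 eqs′)))

Realizable1≢without𝟏 : {S T : CubeSubset} → Realizable1 n S → Realizable1 n T →
                       S ≢ without𝟏 n T
Realizable1≢without𝟏 {n} (eqs , refl) (eqs′ , refl) eq = true≢false (begin
  true                             ≡⟨ sols1-𝟏 eqs ⟨
  sols1 eqs 𝟏                      ≡⟨ table-injective (trans eq (without𝟏-table _)) 𝟏 ⟩
  sols1 eqs′ 𝟏 ∧ not (is𝟏 (𝟏 {n})) ≡⟨ cong (λ b → sols1 eqs′ 𝟏 ∧ not b) (evalMon-𝟏 (allFin n)) ⟩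
  sols1 eqs′ 𝟏 ∧ false             ≡⟨ ∧-zeroʳ _ ⟩
  false                            ∎)
  where
  open ≡-Reasoning
  true≢false : true ≢ false
  true≢false ()

lift01 : Equation n → Term01 n × Term01 n
lift01 = Product.map just just

sols01-lift01 : (eqs : List (Equation n)) → sols01 (map lift01 eqs) ≗ sols1 eqs
sols01-lift01 eqs x = allB-map-≗ lift01 (λ _ → refl) eqs

full≡0 : Term01 n × Term01 n
full≡0 {n} = just (allFin n) , nothing

sols01-full≡0 : (eqs : List (Equation n)) (x : Point n) →
                sols01 (map lift01 eqs ++ full≡0 ∷ []) x ≡ sols1 eqs x ∧ not (is𝟏 x)
sols01-full≡0 eqs x =
  trans (allB-++ _ (map lift01 eqs) (full≡0 ∷ []))
        (cong₂ _∧_ (sols01-lift01 eqs x) (≡false (is𝟏 x)))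
  where
  ≡false : ∀ b → (b ==b false) ∧ true ≡ not b
  ≡false true  = refl
  ≡false false = refl

zeroAsFull : Term01 n → Monomial n
zeroAsFull (just m) = m
zeroAsFull {n} nothing = allFin n

zeroAsFullEq : Term01 n × Term01 n → Equation n
zeroAsFullEq = Product.map zeroAsFull zeroAsFull

sols01-off𝟏 : {x : Point n} → is𝟏 x ≡ false → (eqs : List (Term01 n × Term01 n)) →
              sols01 eqs x ≡ sols1 (map zeroAsFullEq eqs) x
sols01-off𝟏 {x = x} x≢𝟏 eqs = sym (allB-map-≗ zeroAsFullEq same-equation eqs)
  where
  evalTerm01-zeroAsFull : (t : Term01 _) → evalMon (zeroAsFull t) x ≡ evalTerm01 t x
  evalTerm01-zeroAsFull (just m) = refl
  evalTerm01-zeroAsFull nothing  = x≢𝟏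
  same-equation : ∀ e → holds (zeroAsFullEq e) x ≡ holds01 e x
  same-equation (t₁ , t₂) = cong₂ _==b_ (evalTerm01-zeroAsFull t₁) (evalTerm01-zeroAsFull t₂)

sols01-𝟏-true : (eqs : List (Term01 n × Term01 n)) → sols01 eqs 𝟏 ≡ true →
                sols01 eqs ≗ sols1 (map zeroAsFullEq eqs)
sols01-𝟏-true eqs at𝟏 =
  ≗-by-𝟏 (trans at𝟏 (sym (sols1-𝟏 (map zeroAsFullEq eqs)))) (λ _ x≢𝟏 → sols01-off𝟏 x≢𝟏 eqs)

sols01-𝟏-false : (eqs : List (Term01 n × Term01 n)) → sols01 eqs 𝟏 ≡ false →
                 sols01 eqs ≗ λ x → sols1 (map zeroAsFullEq eqs) x ∧ not (is𝟏 x)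
sols01-𝟏-false {n} eqs at𝟏 = ≗-by-𝟏 at-𝟏 off-𝟏
  where
  eqs₁ = map zeroAsFullEq eqs
  at-𝟏 : sols01 eqs 𝟏 ≡ sols1 eqs₁ 𝟏 ∧ not (is𝟏 (𝟏 {n}))
  at-𝟏 = sym (trans (cong (λ b → sols1 eqs₁ 𝟏 ∧ not b) (evalMon-𝟏 (allFin n)))
                    (trans (∧-zeroʳ _) (sym at𝟏)))
  off-𝟏 : ∀ x → is𝟏 x ≡ false → sols01 eqs x ≡ sols1 eqs₁ x ∧ not (is𝟏 x)
  off-𝟏 x x≢𝟏 = sym (trans (cong (λ b → sols1 eqs₁ x ∧ not b) x≢𝟏)
                           (trans (∧-identityʳ _) (sym (sols01-off𝟏 x≢𝟏 eqs))))

Realizable01⇔Realizable1⊎without𝟏 : (S : CubeSubset) →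
  Realizable01 n S ⇔ (Realizable1 n S ⊎ ∃ λ T → Realizable1 n T × S ≡ without𝟏 n T)
Realizable01⇔Realizable1⊎without𝟏 {n} S = mk⇔ split unsplit
  where
  split : Realizable01 n S → Realizable1 n S ⊎ ∃ λ T → Realizable1 n T × S ≡ without𝟏 n T
  split (eqs , refl) with sols01 eqs 𝟏 in at𝟏
  ... | true  = inj₁ (map zeroAsFullEq eqs , table-cong (sols01-𝟏-true eqs at𝟏))
  ... | false = inj₂ (_ , (map zeroAsFullEq eqs , refl) ,
                      trans (table-cong (sols01-𝟏-false eqs at𝟏)) (sym (without𝟏-table _)))
  unsplit : Realizable1 n S ⊎ (∃ λ T → Realizable1 n T × S ≡ without𝟏 n T) → Realizable01 n S
  unsplit (inj₁ (eqs , refl)) = map lift01 eqs , table-cong (sym ∘ sols01-lift01 eqs)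
  unsplit (inj₂ (_ , (eqs , refl) , refl)) =
    map lift01 eqs ++ full≡0 ∷ [] ,
    trans (without𝟏-table (sols1 eqs)) (table-cong (sym ∘ sols01-full≡0 eqs))

H1-count : (n : ℕ) → ∃ (H1is n)
H1-count n = _ , HasCount-enumeration (realizations1 n) (∈-realizations1⇔Realizable1 {n})

mainTheorem2 : (n : ℕ) → Σ ℕ (λ k → H1is n k × H01is n (2 * k))
mainTheorem2 n with H1-count n
... | k , H₁ = k , H₁ , HasCount-⇔ H₁-doubled (⇔-sym ∘ Realizable01⇔Realizable1⊎without𝟏)
  where
  H₁-doubled : HasCount (λ S → Realizable1 n S ⊎ ∃ λ T → Realizable1 n T × S ≡ without𝟏 n T) (2 * k)
  H₁-doubled = HasCount-⊎-image (without𝟏 n) H₁ without𝟏-injective Realizable1≢without𝟏
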